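{- Let $G\le\mathrm{GL}_n\times\mathrm{GL}_m\times\mathrm{GL}_\ell$ and let $\hat G=\{(g_1,g_2\oplus h_2,g_3\oplus h_3):(g_1,g_2,g_3)\in G,\ h_2\in\mathrm{GL}_{m'},\ h_3\in\mathrm{GL}_{\ell'}\}$. Let $\Gamma$ be an $n\times m'\times\ell'$ tensor and $H=\{g_1\in\mathrm{GL}_n:\exists h_2,h_3,\ (g_1,h_2,h_3)\cdot\Gamma=\Gamma\}$. Then for any two $n\times m\times\ell$ tensors $\mathtt{A},\mathtt{B}$: $\mathtt{A}$ and $\mathtt{B}$ are $(G\cap(H\times\mathrm{GL}_m\times\mathrm{GL}_\ell))$-isomorphic if and only if $\mathtt{A}\boxplus_1\Gamma$ and $\mathtt{B}\boxplus_1\Gamma$ are $\hat G$-isomorphic. Furthermore, $\mathrm{Iso}_{\hat G}(\mathtt{A}\boxplus_1\Gamma,\mathtt{B}\boxplus_1\Gamma)=\{(g_1,g_2\oplus h_2,g_3\oplus h_3):(g_1,g_2,g_3)\in\mathrm{Iso}_G(\mathtt{A},\mathtt{B}),\ (g_1,h_2,h_3)\in\mathrm{Aut}(\Gamma)\}$.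
   Context: All groups are over a fixed field $\mathbb{F}$; $(P,Q,R)$ acts on a 3-way array $(a_{i,j,k})$ by $a'_{i,j,k}=\sum P_{i,i'}Q_{j,j'}R_{k,k'}a_{i',j',k'}$. For $\mathtt{A}$ of size $n\times m\times\ell$ and $\Gamma$ of size $n\times m'\times\ell'$, $\mathtt{A}\boxplus_1\Gamma$ is the $n\times(m+m')\times(\ell+\ell')$ array whose first $\ell$ frontal slices are $[A_i\ 0]$ and last $\ell'$ frontal slices are $[0\ \Gamma_i]$ ($A_i,\Gamma_i$ the frontal slices). $g\oplus h$ denotes the block-diagonal matrix. For a subset $K$ of the acting group, $\mathrm{Iso}_K(\mathtt{A},\mathtt{B})$ is the set of elements of $K$ sending $\mathtt{A}$ to $\mathtt{B}$, and $\mathtt{A},\mathtt{B}$ are $K$-isomorphic if it is nonempty; $\mathrm{Aut}(\Gamma)$ is the stabilizer of $\Gamma$. -}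

module Defs where

open import Level using (Level; _⊔_; suc)
open import Data.Nat using (ℕ) renaming (_+_ to _+ℕ_)
open import Data.Fin using (Fin; splitAt)
open import Data.Sum using (_⊎_; inj₁; inj₂)
open import Data.Product using (_×_; _,_; Σ; ∃; ∃-syntax)
open import Relation.Nullary using (¬_)
open import Algebra.Bundles using (CommutativeRing)
import Algebra.Definitions.RawMonoid as RawMonoidDefs

record Field (c ℓ : Level) : Set (Level.suc (c ⊔ ℓ)) where
  field
    commutativeRing : CommutativeRing c ℓ
  open CommutativeRing commutativeRing public
  field
    0≉1     : ¬ (0# ≈ 1#)
    inverse : ∀ x → ¬ (x ≈ 0#) → ∃[ y ] (x * y ≈ 1#)

module FieldDefs {c ℓ : Level} (F : Field c ℓ) where
  open Field F
  open RawMonoidDefs +-rawMonoid using (sum)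

  Mat : ℕ → ℕ → Set c
  Mat r s = Fin r → Fin s → Carrier

  Tensor : ℕ → ℕ → ℕ → Set c
  Tensor n m l = Fin n → Fin m → Fin l → Carrier

  _≈M_ : ∀ {r s} → Mat r s → Mat r s → Set ℓ
  P ≈M Q = ∀ i j → P i j ≈ Q i j

  _≈T_ : ∀ {n m l} → Tensor n m l → Tensor n m l → Set ℓ
  A ≈T B = ∀ i j k → A i j k ≈ B i j k

  _·M_ : ∀ {r s t} → Mat r s → Mat s t → Mat r t
  (P ·M Q) i k = sum (λ j → P i j * Q j k)

  I : ∀ {r} → Mat r r
  I {r} i j with i Data.Fin.≟ j
  ... | Relation.Nullary.yes _ = 1#
  ... | Relation.Nullary.no  _ = 0#

  IsInverse : ∀ {r} → Mat r r → Mat r r → Set ℓ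
  IsInverse P Q = ((P ·M Q) ≈M I) × ((Q ·M P) ≈M I)

  IsGL : ∀ {r} → Mat r r → Set (c ⊔ ℓ)
  IsGL {r} P = ∃[ Q ] IsInverse P Q

  Triple : ℕ → ℕ → ℕ → Set c
  Triple n m l = Mat n n × Mat m m × Mat l l

  _≈Tr_ : ∀ {n m l} → Triple n m l → Triple n m l → Set ℓ
  (P , Q , R) ≈Tr (P' , Q' , R') = (P ≈M P') × (Q ≈M Q') × (R ≈M R')

  InGL3 : ∀ {n m l} → Triple n m l → Set (c ⊔ ℓ)
  InGL3 (P , Q , R) = IsGL P × IsGL Q × IsGL R

  act : ∀ {n m l} → Triple n m l → Tensor n m l → Tensor n m l
  act (P , Q , R) A i j k =
    sum (λ i' → sum (λ j' → sum (λ k' →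
      P i i' * Q j j' * R k k' * A i' j' k')))

  _⊕_ : ∀ {r s} → Mat r r → Mat s s → Mat (r +ℕ s) (r +ℕ s)
  _⊕_ {r} {s} g h i j with splitAt r i | splitAt r j
  ... | inj₁ i' | inj₁ j' = g i' j'
  ... | inj₂ i' | inj₂ j' = h i' j'
  ... | inj₁ _  | inj₂ _  = 0#
  ... | inj₂ _  | inj₁ _  = 0#

  _⊞₁_ : ∀ {n m l m' l'} → Tensor n m l → Tensor n m' l' →
         Tensor n (m +ℕ m') (l +ℕ l')
  _⊞₁_ {n} {m} {l} A Γ i j k with splitAt m j | splitAt l k
  ... | inj₁ j' | inj₁ k' = A i j' k'
  ... | inj₂ j' | inj₂ k' = Γ i j' k'
  ... | inj₁ _  | inj₂ _  = 0#
  ... | inj₂ _  | inj₁ _  = 0#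

  Subset3 : ℕ → ℕ → ℕ → Set (Level.suc (c ⊔ ℓ))
  Subset3 n m l = Triple n m l → Set (c ⊔ ℓ)

  record IsSubgroup {n m l : ℕ} (G : Subset3 n m l) : Set (Level.suc (c ⊔ ℓ)) where
    field
      respects : ∀ {x y} → x ≈Tr y → G x → G y
      ⊆GL      : ∀ {x} → G x → InGL3 x
      one      : G (I , I , I)
      mul      : ∀ {P Q R P' Q' R'} → G (P , Q , R) → G (P' , Q' , R') →
                 G ((P ·M P') , (Q ·M Q') , (R ·M R'))
      inv      : ∀ {P Q R P' Q' R'} → G (P , Q , R) →
                 IsInverse P P' → IsInverse Q Q' → IsInverse R R' →
                 G (P' , Q' , R')

  Iso : ∀ {n m l} → Subset3 n m l → Tensor n m l → Tensor n m l → Subset3 n m l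
  Iso K A B x = K x × (act x A ≈T B)

  Isomorphic : ∀ {n m l} → Subset3 n m l → Tensor n m l → Tensor n m l → Set (c ⊔ ℓ)
  Isomorphic K A B = ∃[ x ] Iso K A B x

  GL3 : ∀ {n m l} → Subset3 n m l
  GL3 = InGL3

  Aut : ∀ {n m l} → Tensor n m l → Subset3 n m l
  Aut Γ = Iso GL3 Γ Γ

  Ghat : ∀ {n m l} m' l' → Subset3 n m l → Subset3 n (m +ℕ m') (l +ℕ l')
  Ghat m' l' G x =
    Σ (Mat _ _ × Mat _ _ × Mat _ _) λ { (g1 , g2 , g3) →
    Σ (Mat m' m') λ h2 → Σ (Mat l' l') λ h3 →
      G (g1 , g2 , g3) × IsGL h2 × IsGL h3 ×
      (x ≈Tr (g1 , (g2 ⊕ h2) , (g3 ⊕ h3))) }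

  Hgrp : ∀ {n m' l'} → Tensor n m' l' → Mat n n → Set (c ⊔ ℓ)
  Hgrp {n} {m'} {l'} Γ g1 =
    IsGL g1 × (Σ (Mat m' m') λ h2 → Σ (Mat l' l') λ h3 →
      IsGL h2 × IsGL h3 × (act (g1 , h2 , h3) Γ ≈T Γ))

  GcapH : ∀ {n m l m' l'} → Subset3 n m l → Tensor n m' l' → Subset3 n m l
  GcapH G Γ (g1 , g2 , g3) = G (g1 , g2 , g3) × Hgrp Γ g1 × IsGL g2 × IsGL g3

{-# OPTIONS --safe #-}
-- A triple (g₁ , g₂ ⊕ h₂ , g₃ ⊕ h₃) acts on A ⊞₁ Γ block by block: the diagonal
-- blocks become (g₁ , g₂ , g₃) · A and (g₁ , h₂ , h₃) · Γ, and the zero off-diagonal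
-- blocks stay zero. Since A ⊞₁ Γ determines A and Γ, such a triple sends A ⊞₁ Γ to
-- B ⊞₁ Γ exactly when (g₁ , g₂ , g₃) sends A to B and (g₁ , h₂ , h₃) fixes Γ, and
-- the latter is precisely a witness that g₁ ∈ H.
module Submission where

open import Defs
open import Level using (Level; _⊔_)
open import Data.Nat using (ℕ; zero; suc) renaming (_+_ to _+ℕ_)
open import Data.Fin using (Fin; splitAt; _↑ˡ_; _↑ʳ_)
open import Data.Fin.Properties using (splitAt-↑ˡ; splitAt-↑ʳ; splitAt⁻¹-↑ˡ; splitAt⁻¹-↑ʳ)
open import Data.Sum using (inj₁; inj₂)
open import Data.Product using (_×_; _,_; Σ; proj₁; proj₂)
open import Function using (_∘_; Equivalence)
open import Function.Bundles using (_⇔_; mk⇔)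
open import Algebra.Bundles using (Monoid)
open import Relation.Binary.PropositionalEquality as ≡ using (_≡_)

↑-elim : ∀ {a b p} (P : Fin (a +ℕ b) → Set p) →
         (∀ i → P (i ↑ˡ b)) → (∀ i → P (a ↑ʳ i)) → ∀ j → P j
↑-elim {a} {b} P left right j with splitAt a {b} j in eq
... | inj₁ i = ≡.subst P (splitAt⁻¹-↑ˡ eq) (left i)
... | inj₂ i = ≡.subst P (splitAt⁻¹-↑ʳ eq) (right i)

module MonoidSum {c ℓ} (M : Monoid c ℓ) where
  open Monoid M
  open import Algebra.Properties.Monoid.Sum M public using (sum; sum-cong-≋; sum-replicate-zero)

  sum-zero : ∀ {k} {f : Fin k → Carrier} → (∀ i → f i ≈ ε) → sum f ≈ ε
  sum-zero {k} f≈ε = trans (sum-cong-≋ f≈ε) (sum-replicate-zero k)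

  sum-↑ : ∀ {a b} (f : Fin (a +ℕ b) → Carrier) →
          sum f ≈ sum (f ∘ (_↑ˡ b)) ∙ sum (f ∘ (a ↑ʳ_))
  sum-↑ {zero}  f = sym (identityˡ _)
  sum-↑ {suc a} f = trans (∙-congˡ (sum-↑ {a} (f ∘ Fin.suc))) (sym (assoc _ _ _))

  sum-↑ˡ : ∀ {a b} (f : Fin (a +ℕ b) → Carrier) → (∀ i → f (a ↑ʳ i) ≈ ε) →
           sum f ≈ sum (f ∘ (_↑ˡ b))
  sum-↑ˡ {a} f f≈ε = trans (sum-↑ {a} f) (trans (∙-congˡ (sum-zero f≈ε)) (identityʳ _))

  sum-↑ʳ : ∀ {a b} (f : Fin (a +ℕ b) → Carrier) → (∀ i → f (i ↑ˡ b) ≈ ε) →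
           sum f ≈ sum (f ∘ (a ↑ʳ_))
  sum-↑ʳ {a} f f≈ε = trans (sum-↑ {a} f) (trans (∙-congʳ (sum-zero f≈ε)) (identityˡ _))

module BlockAction {c ℓ} (F : Field c ℓ) where
  open Field F
  open FieldDefs F
  open MonoidSum +-monoid

  ≈T-trans : ∀ {n m l} {X Y Z : Tensor n m l} → X ≈T Y → Y ≈T Z → X ≈T Z
  ≈T-trans X≈Y Y≈Z i j k = trans (X≈Y i j k) (Y≈Z i j k)

  ≈T-sym : ∀ {n m l} {X Y : Tensor n m l} → X ≈T Y → Y ≈T X
  ≈T-sym X≈Y i j k = sym (X≈Y i j k)

  ≈Tr-refl : ∀ {n m l} (x : Triple n m l) → x ≈Tr x
  ≈Tr-refl _ = (λ _ _ → refl) , (λ _ _ → refl) , (λ _ _ → refl)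

  module _ {r s} (g : Mat r r) (h : Mat s s) where
    ⊕-ˡˡ : ∀ a b → (g ⊕ h) (a ↑ˡ s) (b ↑ˡ s) ≡ g a b
    ⊕-ˡˡ a b rewrite splitAt-↑ˡ r a s | splitAt-↑ˡ r b s = ≡.refl

    ⊕-ˡʳ : ∀ a b → (g ⊕ h) (a ↑ˡ s) (r ↑ʳ b) ≡ 0#
    ⊕-ˡʳ a b rewrite splitAt-↑ˡ r a s | splitAt-↑ʳ r s b = ≡.refl

    ⊕-ʳˡ : ∀ a b → (g ⊕ h) (r ↑ʳ a) (b ↑ˡ s) ≡ 0#
    ⊕-ʳˡ a b rewrite splitAt-↑ʳ r s a | splitAt-↑ˡ r b s = ≡.refl

    ⊕-ʳʳ : ∀ a b → (g ⊕ h) (r ↑ʳ a) (r ↑ʳ b) ≡ h a b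
    ⊕-ʳʳ a b rewrite splitAt-↑ʳ r s a | splitAt-↑ʳ r s b = ≡.refl

  module _ {n m l m' l'} (A : Tensor n m l) (Γ : Tensor n m' l') where
    ⊞₁-ˡˡ : ∀ i a b → (A ⊞₁ Γ) i (a ↑ˡ m') (b ↑ˡ l') ≡ A i a b
    ⊞₁-ˡˡ i a b rewrite splitAt-↑ˡ m a m' | splitAt-↑ˡ l b l' = ≡.refl

    ⊞₁-ˡʳ : ∀ i a b → (A ⊞₁ Γ) i (a ↑ˡ m') (l ↑ʳ b) ≡ 0#
    ⊞₁-ˡʳ i a b rewrite splitAt-↑ˡ m a m' | splitAt-↑ʳ l l' b = ≡.refl

    ⊞₁-ʳˡ : ∀ i a b → (A ⊞₁ Γ) i (m ↑ʳ a) (b ↑ˡ l') ≡ 0#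
    ⊞₁-ʳˡ i a b rewrite splitAt-↑ʳ m m' a | splitAt-↑ˡ l b l' = ≡.refl

    ⊞₁-ʳʳ : ∀ i a b → (A ⊞₁ Γ) i (m ↑ʳ a) (l ↑ʳ b) ≡ Γ i a b
    ⊞₁-ʳʳ i a b rewrite splitAt-↑ʳ m m' a | splitAt-↑ʳ l l' b = ≡.refl

  ⊞₁-intro : ∀ {n m l m' l'} {A : Tensor n m l} {Γ : Tensor n m' l'}
             (Y : Tensor n (m +ℕ m') (l +ℕ l')) →
             (∀ i a b → Y i (a ↑ˡ m') (b ↑ˡ l') ≈ A i a b) →
             (∀ i a b → Y i (a ↑ˡ m') (l ↑ʳ b) ≈ 0#) →
             (∀ i a b → Y i (m ↑ʳ a) (b ↑ˡ l') ≈ 0#) →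
             (∀ i a b → Y i (m ↑ʳ a) (l ↑ʳ b) ≈ Γ i a b) →
             Y ≈T (A ⊞₁ Γ)
  ⊞₁-intro {A = A} {Γ} Y ll lr rl rr i =
    ↑-elim (λ j → ∀ k → Y i j k ≈ (A ⊞₁ Γ) i j k)
      (λ a → ↑-elim _
        (λ b → trans (ll i a b) (reflexive (≡.sym (⊞₁-ˡˡ A Γ i a b))))
        (λ b → trans (lr i a b) (reflexive (≡.sym (⊞₁-ˡʳ A Γ i a b)))))
      (λ a → ↑-elim _
        (λ b → trans (rl i a b) (reflexive (≡.sym (⊞₁-ʳˡ A Γ i a b))))
        (λ b → trans (rr i a b) (reflexive (≡.sym (⊞₁-ʳʳ A Γ i a b)))))

  ⊞₁-cong : ∀ {n m l m' l'} {A B : Tensor n m l} {Γ Δ : Tensor n m' l'} →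
            A ≈T B → Γ ≈T Δ → (A ⊞₁ Γ) ≈T (B ⊞₁ Δ)
  ⊞₁-cong {A = A} {Γ = Γ} A≈B Γ≈Δ = ⊞₁-intro (A ⊞₁ Γ)
    (λ i a b → trans (reflexive (⊞₁-ˡˡ A Γ i a b)) (A≈B i a b))
    (λ i a b → reflexive (⊞₁-ˡʳ A Γ i a b))
    (λ i a b → reflexive (⊞₁-ʳˡ A Γ i a b))
    (λ i a b → trans (reflexive (⊞₁-ʳʳ A Γ i a b)) (Γ≈Δ i a b))

  ⊞₁-injective : ∀ {n m l m' l'} {A B : Tensor n m l} {Γ Δ : Tensor n m' l'} →
                 (A ⊞₁ Γ) ≈T (B ⊞₁ Δ) → (A ≈T B) × (Γ ≈T Δ)
  ⊞₁-injective {m = m} {l} {m'} {l'} {A} {B} {Γ} {Δ} e =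
    (λ i a b → trans (reflexive (≡.sym (⊞₁-ˡˡ A Γ i a b)))
                     (trans (e i (a ↑ˡ m') (b ↑ˡ l')) (reflexive (⊞₁-ˡˡ B Δ i a b)))) ,
    (λ i a b → trans (reflexive (≡.sym (⊞₁-ʳʳ A Γ i a b)))
                     (trans (e i (m ↑ʳ a) (l ↑ʳ b)) (reflexive (⊞₁-ʳʳ B Δ i a b))))

  act-congˡ : ∀ {n m l} {x y : Triple n m l} (A : Tensor n m l) → x ≈Tr y → act x A ≈T act y A
  act-congˡ A (P≈ , Q≈ , R≈) i j k =
    sum-cong-≋ λ i' → sum-cong-≋ λ j' → sum-cong-≋ λ k' →
      *-congʳ (*-cong (*-cong (P≈ i i') (Q≈ j j')) (R≈ k k'))

  act-congʳ : ∀ {n m l} (x : Triple n m l) {A B : Tensor n m l} → A ≈T B → act x A ≈T act x B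
  act-congʳ x A≈B i j k =
    sum-cong-≋ λ i' → sum-cong-≋ λ j' → sum-cong-≋ λ k' → *-congˡ (A≈B i' j' k')

  act-zero : ∀ {n m l} (x : Triple n m l) {A : Tensor n m l} →
             (∀ i j k → A i j k ≈ 0#) → ∀ i j k → act x A i j k ≈ 0#
  act-zero x A≈0 i j k =
    sum-zero λ i' → sum-zero λ j' → sum-zero λ k' → trans (*-congˡ (A≈0 i' j' k')) (zeroʳ _)

  -- u vanishes off the image of e and agrees with v along e, phrased as what this
  -- allows: contracting u against any summand that vanishes at 0#.
  SupportedOn : ∀ {N p} → (Fin N → Carrier) → (Fin p → Fin N) → (Fin p → Carrier) → Set (c ⊔ ℓ)
  SupportedOn {N} u e v = ∀ (φ : Carrier → Fin N → Carrier) → (∀ j → φ 0# j ≈ 0#) →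
                          sum (λ j → φ (u j) j) ≈ sum (λ j → φ (v j) (e j))

  module _ {r s} (g : Mat r r) (h : Mat s s) where
    ⊕-row-↑ˡ : ∀ a → SupportedOn ((g ⊕ h) (a ↑ˡ s)) (_↑ˡ s) (g a)
    ⊕-row-↑ˡ a φ φ0≈0 =
      trans (sum-↑ˡ {r} _ λ b → trans (reflexive (≡.cong (λ x → φ x _) (⊕-ˡʳ g h a b))) (φ0≈0 _))
            (sum-cong-≋ λ b → reflexive (≡.cong (λ x → φ x _) (⊕-ˡˡ g h a b)))

    ⊕-row-↑ʳ : ∀ a → SupportedOn ((g ⊕ h) (r ↑ʳ a)) (r ↑ʳ_) (h a)
    ⊕-row-↑ʳ a φ φ0≈0 =
      trans (sum-↑ʳ {r} _ λ b → trans (reflexive (≡.cong (λ x → φ x _) (⊕-ʳˡ g h a b))) (φ0≈0 _))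
            (sum-cong-≋ λ b → reflexive (≡.cong (λ x → φ x _) (⊕-ʳʳ g h a b)))

  act-contract : ∀ {n M L p q} (P : Mat n n) (Q : Mat M M) (R : Mat L L)
                 (Q′ : Mat p p) (R′ : Mat q q) (X : Tensor n M L)
                 {e₂ : Fin p → Fin M} {e₃ : Fin q → Fin L} {i j k a b} →
                 SupportedOn (Q j) e₂ (Q′ a) → SupportedOn (R k) e₃ (R′ b) →
                 act (P , Q , R) X i j k ≈
                 act (P , Q′ , R′) (λ i' j' k' → X i' (e₂ j') (e₃ k')) i a b
  act-contract {L = L} P Q R Q′ R′ X {e₂} {i = i} {k = k} {a} Qj Rk = sum-cong-≋ λ i' →
    trans (Qj (λ x j' → sum λ k' → P i i' * x * R k k' * X i' j' k')
              (λ _ → sum-zero {L} λ _ → zero-second))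
          (sum-cong-≋ λ j' → Rk (λ x k' → P i i' * Q′ a j' * x * X i' (e₂ j') k')
                                (λ _ → zero-third))
    where
    zero-second : ∀ {u v w} → u * 0# * v * w ≈ 0#
    zero-second = trans (*-congʳ (trans (*-congʳ (zeroʳ _)) (zeroˡ _))) (zeroˡ _)
    zero-third : ∀ {u v w} → u * v * 0# * w ≈ 0#
    zero-third = trans (*-congʳ (zeroʳ _)) (zeroˡ _)

  act-⊕-⊞₁ : ∀ {n m l m' l'} (g₁ : Mat n n) (g₂ : Mat m m) (g₃ : Mat l l)
             (h₂ : Mat m' m') (h₃ : Mat l' l') (A : Tensor n m l) (Γ : Tensor n m' l') →
             act (g₁ , g₂ ⊕ h₂ , g₃ ⊕ h₃) (A ⊞₁ Γ) ≈T
             (act (g₁ , g₂ , g₃) A ⊞₁ act (g₁ , h₂ , h₃) Γ)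
  act-⊕-⊞₁ g₁ g₂ g₃ h₂ h₃ A Γ = ⊞₁-intro _
    (λ i a b → trans (act-contract g₁ (g₂ ⊕ h₂) (g₃ ⊕ h₃) g₂ g₃ (A ⊞₁ Γ)
                                   (⊕-row-↑ˡ g₂ h₂ a) (⊕-row-↑ˡ g₃ h₃ b))
                     (act-congʳ (g₁ , g₂ , g₃) (λ i' j' k' → reflexive (⊞₁-ˡˡ A Γ i' j' k')) i a b))
    (λ i a b → trans (act-contract g₁ (g₂ ⊕ h₂) (g₃ ⊕ h₃) g₂ h₃ (A ⊞₁ Γ)
                                   (⊕-row-↑ˡ g₂ h₂ a) (⊕-row-↑ʳ g₃ h₃ b))
                     (act-zero (g₁ , g₂ , h₃) (λ i' j' k' → reflexive (⊞₁-ˡʳ A Γ i' j' k')) i a b))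
    (λ i a b → trans (act-contract g₁ (g₂ ⊕ h₂) (g₃ ⊕ h₃) h₂ g₃ (A ⊞₁ Γ)
                                   (⊕-row-↑ʳ g₂ h₂ a) (⊕-row-↑ˡ g₃ h₃ b))
                     (act-zero (g₁ , h₂ , g₃) (λ i' j' k' → reflexive (⊞₁-ʳˡ A Γ i' j' k')) i a b))
    (λ i a b → trans (act-contract g₁ (g₂ ⊕ h₂) (g₃ ⊕ h₃) h₂ h₃ (A ⊞₁ Γ)
                                   (⊕-row-↑ʳ g₂ h₂ a) (⊕-row-↑ʳ g₃ h₃ b))
                     (act-congʳ (g₁ , h₂ , h₃) (λ i' j' k' → reflexive (⊞₁-ʳʳ A Γ i' j' k')) i a b))

  act-⊞₁-≈⇔ : ∀ {n m l m' l'} {x : Triple n (m +ℕ m') (l +ℕ l')}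
              {g₁ : Mat n n} {g₂ : Mat m m} {g₃ : Mat l l} {h₂ : Mat m' m'} {h₃ : Mat l' l'}
              {A B : Tensor n m l} {Γ Δ : Tensor n m' l'} →
              x ≈Tr (g₁ , g₂ ⊕ h₂ , g₃ ⊕ h₃) →
              act x (A ⊞₁ Γ) ≈T (B ⊞₁ Δ) ⇔
              (act (g₁ , g₂ , g₃) A ≈T B × act (g₁ , h₂ , h₃) Γ ≈T Δ)
  act-⊞₁-≈⇔ {x = x} {g₁ = g₁} {g₂} {g₃} {h₂} {h₃} {A} {Γ = Γ} x≈ = mk⇔
    (λ e → ⊞₁-injective (≈T-trans (≈T-sym blockwise) e))
    (λ (gA≈B , hΓ≈Δ) → ≈T-trans blockwise (⊞₁-cong gA≈B hΓ≈Δ))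
    where
    blockwise : act x (A ⊞₁ Γ) ≈T (act (g₁ , g₂ , g₃) A ⊞₁ act (g₁ , h₂ , h₃) Γ)
    blockwise = ≈T-trans (act-congˡ (A ⊞₁ Γ) x≈) (act-⊕-⊞₁ g₁ g₂ g₃ h₂ h₃ A Γ)

  module _ {n m l m' l'} {G : Subset3 n m l} (G⊆GL : ∀ {x} → G x → InGL3 x)
           (Γ : Tensor n m' l') (A B : Tensor n m l) where

    Iso-Ghat⇔ : ∀ x → Iso (Ghat m' l' G) (A ⊞₁ Γ) (B ⊞₁ Γ) x ⇔
                (Σ (Mat n n × Mat m m × Mat l l) λ g →
                 Σ (Mat m' m') λ h2 → Σ (Mat l' l') λ h3 →
                   Iso G A B g × Aut Γ (proj₁ g , h2 , h3) ×
                   (x ≈Tr (proj₁ g , (proj₁ (proj₂ g) ⊕ h2) , (proj₂ (proj₂ g) ⊕ h3))))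
    Iso-Ghat⇔ x = mk⇔
      (λ ((g , h₂ , h₃ , g∈G , GL-h₂ , GL-h₃ , x≈) , x·A⊞Γ≈B⊞Γ) →
        let g·A≈B , h·Γ≈Γ = Equivalence.to (act-⊞₁-≈⇔ x≈) x·A⊞Γ≈B⊞Γ in
        g , h₂ , h₃ , (g∈G , g·A≈B) , ((proj₁ (G⊆GL g∈G) , GL-h₂ , GL-h₃) , h·Γ≈Γ) , x≈)
      (λ (g , h₂ , h₃ , (g∈G , g·A≈B) , ((_ , GL-h₂ , GL-h₃) , h·Γ≈Γ) , x≈) →
        (g , h₂ , h₃ , g∈G , GL-h₂ , GL-h₃ , x≈) ,
        Equivalence.from (act-⊞₁-≈⇔ x≈) (g·A≈B , h·Γ≈Γ))

    Isomorphic-GcapH⇔Isomorphic-Ghat :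
      Isomorphic (GcapH G Γ) A B ⇔ Isomorphic (Ghat m' l' G) (A ⊞₁ Γ) (B ⊞₁ Γ)
    Isomorphic-GcapH⇔Isomorphic-Ghat = mk⇔
      (λ ((g₁ , g₂ , g₃) , (g∈G , (GL-g₁ , h₂ , h₃ , GL-h₂ , GL-h₃ , h·Γ≈Γ) , _) , g·A≈B) →
        let x = g₁ , g₂ ⊕ h₂ , g₃ ⊕ h₃ in
        x , Equivalence.from (Iso-Ghat⇔ x)
              ((g₁ , g₂ , g₃) , h₂ , h₃ , (g∈G , g·A≈B) ,
               ((GL-g₁ , GL-h₂ , GL-h₃) , h·Γ≈Γ) , ≈Tr-refl x))
      (λ (x , iso) →
        let g , h₂ , h₃ , (g∈G , g·A≈B) , ((GL-g₁ , GL-h₂ , GL-h₃) , h·Γ≈Γ) , _ =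
              Equivalence.to (Iso-Ghat⇔ x) iso in
        g , (g∈G , (GL-g₁ , h₂ , h₃ , GL-h₂ , GL-h₃ , h·Γ≈Γ) , proj₂ (G⊆GL g∈G)) , g·A≈B)

lemma4p6 : ∀ {c ℓ : Level} (F : Field c ℓ) → let open FieldDefs F in
    ∀ {n m l m' l' : ℕ} (G : Subset3 n m l) → IsSubgroup G →
    (Γ : Tensor n m' l') (A B : Tensor n m l) →
    (Isomorphic (GcapH G Γ) A B ⇔ Isomorphic (Ghat m' l' G) (A ⊞₁ Γ) (B ⊞₁ Γ))
    × (∀ x → Iso (Ghat m' l' G) (A ⊞₁ Γ) (B ⊞₁ Γ) x ⇔
         (Σ (Mat n n × Mat m m × Mat l l) λ g →
          Σ (Mat m' m') λ h2 → Σ (Mat l' l') λ h3 →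
            Iso G A B g × Aut Γ (Data.Product.proj₁ g , h2 , h3) ×
            (x ≈Tr (Data.Product.proj₁ g ,
                    (Data.Product.proj₁ (Data.Product.proj₂ g) ⊕ h2) ,
                    (Data.Product.proj₂ (Data.Product.proj₂ g) ⊕ h3)))))
lemma4p6 F G G-subgroup Γ A B =
  Isomorphic-GcapH⇔Isomorphic-Ghat G⊆GL Γ A B , Iso-Ghat⇔ G⊆GL Γ A B
  where
  open BlockAction F
  open FieldDefs.IsSubgroup G-subgroup renaming (⊆GL to G⊆GL)
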